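{- Let $(\mathbf A,\mathbf B,c,s)$ be a valued promise template, $\mathcal M=\mathrm{PolFeas}(\mathbf A,\mathbf B)$, $D,E$ finite disjoint sets, $\epsilon\in\mathbb R$, and $\Xi$ a probability distribution on the set of minion homomorphisms $\mathcal M\to\mathrm{PolFeas}(\mathrm{GLC}_{D,E}(1,\epsilon))$. The following are equivalent: (i) $\Xi$ is a valued minion homomorphism from $\mathrm{Plu}(\mathbf A,\mathbf B,c,s)$ to $\mathrm{Plu}(\mathrm{GLC}_{D,E}(1,\epsilon))$; (ii) for every finite set $N$, every $N$-ary polymorphism $\Omega$ of $(\mathbf A,\mathbf B,c,s)$, every $\pi:D\to E$, every $\mathbf d\in D^N$ and every $\mathbf e\in E^N$: if $\pi(\mathbf d(n))=\mathbf e(n)$ for all $n\in\mathrm{Supp}(\Omega^{\mathrm{in}})$, then $\mathbb E_{(p_D,p_E)\sim\Xi(\Omega^{\mathrm{out}})}\,\pi(p_D(\mathbf d),p_E(\mathbf e))\ge\epsilon$.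
   Context: Probability distributions: rational-valued; $\Delta N$ the probability distributions on a finite set $N$; $\mathrm{Supp}(\mu)=\{n:\mu(n)>0\}$; $g(\mu)$ the pushforward. $\overline{\mathbb{Q}}=\mathbb{Q}\cup\{ -\infty\}$. Multi-sorted setting: fix a finite set $\tau$ of sorts. A $\tau$-sorted set is a set $A$ with $\mathrm{sort}:A\to\tau$, $A_t=\mathrm{sort}^{ -1}(t)$. For $\tau$-sorted $Z,A$, $A^Z$ is the set of sort-preserving maps $Z\to A$; for a plain finite set $N$, $A^N$ is the $\tau$-sorted set of maps $N\to A_t$ (sort $t$). An $N$-ary function from $A$ to $B$ is a sort-preserving $f:A^N\to B$; minor $f^{(\pi)}(\mathbf a)=f(\mathbf a\circ\pi)$. Matrices $M\in A^{Z\times N}$ ($M(z,n)\in A_{\mathrm{sort}(z)}$) have columns $\mathrm{col}_n(M)$, rows $\mathrm{row}_z(M)$; $f\circ\mathrm{rows}(M)$ is $z\mapsto f(\mathrm{row}_zM)$. A signature $\Sigma$: finite set $\sigma$ of symbols with arities $\mathrm{ar}(\phi)$ (finite $\tau$-sorted sets). A valued $\Sigma$-structure: finite $\tau$-sorted domain $A$, maps $\phi^{\mathbf A}:A^{\mathrm{ar}(\phi)}\to\overline{\mathbb Q}$ with nonempty $\mathrm{feas}(\phi^{\mathbf A})=(\phi^{\mathbf A})^{ -1}(\mathbb Q)$. Payoff formulas $\Phi=\sum w_i\phi_i(\mathbf x_i)$ with $w_i\ge0$, $w(\Phi)=\sum w_i$, $\Phi^{\mathbf A}(h)=\sum w_i\phi_i^{\mathbf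 A}(h\circ\mathbf x_i)$. A valued promise template $(\mathbf A,\mathbf B,c,s)$: for every payoff formula $\Phi$, $\exists h\,\Phi^{\mathbf A}(h)\ge c\,w(\Phi)$ implies $\exists h\,\Phi^{\mathbf B}(h)\ge s\,w(\Phi)$. $\mathrm{PolFeas}(\mathbf A,\mathbf B)^{(N)}$: $N$-ary functions $f$ with $f\circ\mathrm{rows}(M)\in\mathrm{feas}(\phi^{\mathbf B})$ whenever $M\in A^{\mathrm{ar}(\phi)\times N}$ has all columns in $\mathrm{feas}(\phi^{\mathbf A})$; a minion under minors. Minions and minion homomorphisms: sets $\mathcal M^{(N)}$ with functorial minor maps; homomorphisms are families of maps commuting with minor maps. Gap Label Cover $\mathrm{GLC}_{D,E}(1,\epsilon)$: sorts $D,E$, domain $D\cup E$, one binary symbol for every function $\pi:D\to E$ with first argument of sort $D$ and second of sort $E$, interpreted in both structures as $\pi(d,e)=1$ if $\pi(d)=e$ and $0$ otherwise; completeness $1$, soundness $\epsilon$. All tuples are feasible, so $\mathrm{PolFeas}(\mathrm{GLC}_{D,E}(1,\epsilon))^{(N)}$ is identified with the set of pairs $(p_D:D^N\to D,\ p_E:E^N\to E)$. Weightings: $\Omega=(\Omega^{\mathrm{in}}\in\Delta N,\Omega^{\mathrm{out}}\in\Delta\mathcal M^{(N)})$; minor along $\pi$: $(\pi(\Omega^{\mathrm{in}}),\mathcal M^{(\pi)}(\Omega^{\mathrm{out}}))$. For $(\phi,M)$ with all columns in $\mathrm{feas}(\phi^{\mathbf A})$: $\Omega^{\mathrm{in}}[\phi,M]=\mathbb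 E_{n\sim\Omega^{\mathrm{in}}}\phi^{\mathbf A}(\mathrm{col}_nM)$, $\Omega^{\mathrm{out}}[\phi,M]=\mathbb E_{f\sim\Omega^{\mathrm{out}}}\phi^{\mathbf B}(f\circ\mathrm{rows}M)$. $\Omega$ is a $\kappa$-polymorphism ($\kappa\in\mathbb Q_{\ge0}$) if $\Omega^{\mathrm{out}}[\phi,M]-s\ge\kappa(\Omega^{\mathrm{in}}[\phi,M]-c)$ for all such $(\phi,M)$, a polymorphism if it is a $\kappa$-polymorphism for some $\kappa$. $\mathrm{Plu}(\mathbf A,\mathbf B,c,s)$: finite families of weightings that are $\kappa$-polymorphisms for a common $\kappa$, indexed by the family of arities. Valued minion over $\mathcal M$: sets of families of weightings indexed by finite families of finite sets, closed under taking families of minors of members. Support minion: $\mathrm{Supp}(\mathbb M)^{(N)}=\bigcup_{\Omega\in\mathbb M^{(N)}}\mathrm{Supp}(\Omega^{\mathrm{out}})$. A valued minion homomorphism $\mathbb M\to\mathbb M'$ is a probability distribution $\Xi$ on minion homomorphisms $\mathrm{Supp}(\mathbb M)\to\mathrm{Supp}(\mathbb M')$ such that for all $(\Omega_j)_j\in\mathbb M^{(\mathcal N)}$, $((\Omega_j^{\mathrm{in}},\Xi(\Omega_j^{\mathrm{out}})))_j\in\mathbb M'^{(\mathcal N)}$, where $\Xi(\Omega^{\mathrm{out}})$ is the law of $\xi(f)$, $\xi\sim\Xi$, $f\sim\Omega^{\mathrm{out}}$ independent. Convention: a distribution $\Xi$ on minion homomorphisms of the full minions $\mathcal M\to\mathrm{PolFeas}(\mathrm{GLC})$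 is regarded as one on homomorphisms between the support minions by restricting each homomorphism.
   Formalization: The soundness parameter ε of $\mathrm{GLC}_{D,E}(1,\epsilon)$ is rational instead of real. -}

module Defs where

open import Data.Nat using (ℕ; zero; suc; _^_)
open import Data.Fin using (Fin; zero; suc; finToFun; _≟_)
open import Data.Rational using (ℚ; 0ℚ; 1ℚ; _+_; _*_; _-_; _≤_; _<_)
open import Data.Maybe using (Maybe; just; nothing)
open import Data.List using (List; []; _∷_; map; concatMap)
open import Data.List.Relation.Unary.All using (All)
open import Data.List.Relation.Unary.Any using (Any)
open import Data.Product using (Σ; ∃; _×_; _,_; proj₁; proj₂)
open import Data.Empty using (⊥)
open import Data.Bool using (if_then_else_)
open import Relation.Nullary.Decidable using (⌊_⌋)
open import Relation.Binary.PropositionalEquality using (_≡_; subst)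

sumFin : (n : ℕ) → (Fin n → ℚ) → ℚ
sumFin zero    g = 0ℚ
sumFin (suc n) g = g zero + sumFin n (λ i → g (suc i))

IsDistFin : (n : ℕ) → (Fin n → ℚ) → Set
IsDistFin n μ = (∀ i → 0ℚ ≤ μ i) × sumFin n μ ≡ 1ℚ

-- a finitely supported distribution on an arbitrary set X, written as a
-- list of (weight , point) pairs (the mass of x is the total weight of the
-- entries carrying x)
Dist : Set → Set
Dist X = List (ℚ × X)

weightSum : {X : Set} → Dist X → ℚ
weightSum []             = 0ℚ
weightSum ((w , _) ∷ μ) = w + weightSum μ

IsDist : {X : Set} → Dist X → Set
IsDist μ = All (λ p → 0ℚ ≤ proj₁ p) μ × weightSum μ ≡ 1ℚ

expect : {X : Set} → Dist X → (X → ℚ) → ℚ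
expect []             g = 0ℚ
expect ((w , x) ∷ μ) g = w * g x + expect μ g

InSupp : {X : Set} → (X → X → Set) → X → Dist X → Set
InSupp _≈_ x μ = Any (λ p → (0ℚ < proj₁ p) × (proj₂ p ≈ x)) μ

record Signature : Set where
  field
    sorts  : ℕ
    nsym   : ℕ
    arN    : Fin nsym → ℕ
    arSort : (φ : Fin nsym) → Fin (arN φ) → Fin sorts
open Signature public

-- a valued Σ-structure: finite τ-sorted domain (dom t = |A_t|), and
-- φ^A : A^{ar φ} → ℚ ∪ {-∞}  (nothing = -∞).
-- Nonemptiness of feas(φ^A) is the separate predicate FeasNonempty.
record ValStr (S : Signature) : Set where
  field
    dom    : Fin (sorts S) → ℕ
    interp : (φ : Fin (nsym S)) → ((z : Fin (arN S φ)) → Fin (dom (arSort S φ z))) → Maybe ℚ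
open ValStr public

Tuple : {S : Signature} → ValStr S → Fin (nsym S) → Set
Tuple {S} A φ = (z : Fin (arN S φ)) → Fin (dom A (arSort S φ z))

Feas : {S : Signature} (A : ValStr S) (φ : Fin (nsym S)) → Tuple A φ → Set
Feas A φ x = ∃ λ q → interp A φ x ≡ just q

FeasNonempty : {S : Signature} → ValStr S → Set
FeasNonempty {S} A = (φ : Fin (nsym S)) → ∃ λ x → Feas A φ x

-- value of a feasible entry (only ever used on feasible entries)
val : Maybe ℚ → ℚ
val (just q) = q
val nothing  = 0ℚ

record Vars (S : Signature) : Set where
  field
    nv    : ℕ
    vsort : Fin nv → Fin (sorts S)
open Vars public

record Term (S : Signature) (V : Vars S) : Set where
  field
    w    : ℚ
    sym  : Fin (nsym S)
    args : (z : Fin (arN S sym)) → Σ (Fin (nv V)) (λ v → vsort V v ≡ arSort S sym z)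
open Term public

PayoffFormula : (S : Signature) → Vars S → Set
PayoffFormula S V = List (Term S V)

Assignment : {S : Signature} → ValStr S → Vars S → Set
Assignment A V = (v : Fin (nv V)) → Fin (dom A (vsort V v))

compose : {S : Signature} (A : ValStr S) {V : Vars S} →
          Assignment A V → (t : Term S V) → Tuple A (sym t)
compose A h t z = subst (λ s → Fin (dom A s)) (proj₂ (args t z)) (h (proj₁ (args t z)))

evalΦ : {S : Signature} (A : ValStr S) {V : Vars S} → PayoffFormula S V → Assignment A V → Maybe ℚ
evalΦ A []      h = just 0ℚ
evalΦ A (t ∷ Φ) h with interp A (sym t) (compose A h t) | evalΦ A Φ h
... | just q  | just r  = just (w t * q + r)
... | just _  | nothing = nothing
... | nothing | _       = nothing

wΦ : {S : Signature} {V : Vars S} → PayoffFormula S V → ℚ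
wΦ []      = 0ℚ
wΦ (t ∷ Φ) = w t + wΦ Φ

_≥̄_ : Maybe ℚ → ℚ → Set
just x  ≥̄ q = q ≤ x
nothing ≥̄ q = ⊥

IsValuedPromiseTemplate : {S : Signature} → ValStr S → ValStr S → ℚ → ℚ → Set
IsValuedPromiseTemplate {S} A B c s =
  FeasNonempty A × FeasNonempty B ×
  ((V : Vars S) (Φ : PayoffFormula S V) → All (λ t → 0ℚ ≤ w t) Φ →
     (∃ λ (h : Assignment A V) → evalΦ A Φ h ≥̄ (c * wΦ Φ)) →
     (∃ λ (h : Assignment B V) → evalΦ B Φ h ≥̄ (s * wΦ Φ)))

module _ {S : Signature} (A B : ValStr S) where

  Fun : ℕ → Set
  Fun n = (t : Fin (sorts S)) → (Fin n → Fin (dom A t)) → Fin (dom B t)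

  Mat : Fin (nsym S) → ℕ → Set
  Mat φ n = (z : Fin (arN S φ)) → Fin n → Fin (dom A (arSort S φ z))

  col : {φ : Fin (nsym S)} {n : ℕ} → Mat φ n → Fin n → Tuple A φ
  col M i z = M z i

  _∘rows_ : {φ : Fin (nsym S)} {n : ℕ} → Fun n → Mat φ n → Tuple B φ
  _∘rows_ {φ} f M z = f (arSort S φ z) (M z)

  IsPolFeas : (n : ℕ) → Fun n → Set
  IsPolFeas n f = (φ : Fin (nsym S)) (M : Mat φ n) →
                  (∀ i → Feas A φ (col M i)) → Feas B φ (f ∘rows M)

  PolFeas : ℕ → Set
  PolFeas n = Σ (Fun n) (IsPolFeas n)

  _≈F_ : {n : ℕ} → PolFeas n → PolFeas n → Set
  f ≈F g = ∀ t a → proj₁ f t a ≡ proj₁ g t a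

  minor : {n n' : ℕ} → (Fin n → Fin n') → PolFeas n → PolFeas n'
  minor π (f , p) = (λ t a → f t (λ i → a (π i))) ,
                    (λ φ M fe → p φ (λ z i → M z (π i)) (λ i → fe (π i)))

  record Weighting (n : ℕ) : Set where
    constructor weighting
    field
      win  : Fin n → ℚ
      wout : Dist (PolFeas n)
  open Weighting public

  IsWeighting : {n : ℕ} → Weighting n → Set
  IsWeighting {n} Ω = IsDistFin n (win Ω) × IsDist (wout Ω)

  inVal : {n : ℕ} → Weighting n → (φ : Fin (nsym S)) → Mat φ n → ℚ
  inVal {n} Ω φ M = sumFin n (λ i → win Ω i * val (interp A φ (col M i)))

  outVal : {n : ℕ} → Weighting n → (φ : Fin (nsym S)) → Mat φ n → ℚ
  outVal Ω φ M = expect (wout Ω) (λ f → val (interp B φ (proj₁ f ∘rows M)))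

  module _ (c s : ℚ) where

    IsκPol : {n : ℕ} → ℚ → Weighting n → Set
    IsκPol {n} κ Ω = (φ : Fin (nsym S)) (M : Mat φ n) → (∀ i → Feas A φ (col M i)) →
                     κ * (inVal Ω φ M - c) ≤ outVal Ω φ M - s

    IsPolymorphism : {n : ℕ} → Weighting n → Set
    IsPolymorphism Ω = IsWeighting Ω × ∃ λ κ → (0ℚ ≤ κ) × IsκPol κ Ω

    InPlu : (m : ℕ) (ns : Fin m → ℕ) → ((j : Fin m) → Weighting (ns j)) → Set
    InPlu m ns Ωs = (∀ j → IsWeighting (Ωs j)) ×
                    ∃ λ κ → (0ℚ ≤ κ) × (∀ j → IsκPol κ (Ωs j))

    SuppPlu : (n : ℕ) → PolFeas n → Set
    SuppPlu n f = ∃ λ (Ω : Weighting n) →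
                  InPlu 1 (λ _ → n) (λ _ → Ω) × InSupp _≈F_ f (wout Ω)

record MinionHom {S S' : Signature} (A B : ValStr S) (A' B' : ValStr S') : Set where
  field
    hom      : {n : ℕ} → PolFeas A B n → PolFeas A' B' n
    respects : {n : ℕ} (f g : PolFeas A B n) → _≈F_ A B f g → _≈F_ A' B' (hom f) (hom g)
    commutes : {n n' : ℕ} (π : Fin n → Fin n') (f : PolFeas A B n) →
               _≈F_ A' B' (hom (minor A B π f)) (minor A' B' π (hom f))
open MinionHom public

-- Ξ(Ω^out): law of ξ(f), ξ ~ Ξ, f ~ Ω^out independent
pushΞ : {S S' : Signature} {A B : ValStr S} {A' B' : ValStr S'} {n : ℕ} →
        Dist (MinionHom A B A' B') → Dist (PolFeas A B n) → Dist (PolFeas A' B' n)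
pushΞ Ξ μ = concatMap (λ wξ → map (λ vf → (proj₁ wξ * proj₁ vf , hom (proj₂ wξ) (proj₂ vf))) μ) Ξ

-- Ξ is a valued minion homomorphism Plu(A,B,c,s) → Plu(A',B',c',s'):
--  * each ξ in Supp(Ξ) restricts to a map Supp(Plu(A,B,c,s)) → Supp(Plu(A',B',c',s'))
--    (the restriction convention), and
--  * for every (Ω_j)_j ∈ Plu(A,B,c,s), ((Ω_j^in , Ξ(Ω_j^out)))_j ∈ Plu(A',B',c',s').
IsValuedMinionHomPlu : {S S' : Signature} (A B : ValStr S) (c s : ℚ) (A' B' : ValStr S') (c' s' : ℚ) →
                       Dist (MinionHom A B A' B') → Set
IsValuedMinionHomPlu A B c s A' B' c' s' Ξ =
  (All (λ wξ → 0ℚ < proj₁ wξ →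
         (n : ℕ) (f : PolFeas A B n) → SuppPlu A B c s n f →
         SuppPlu A' B' c' s' n (hom (proj₂ wξ) f)) Ξ) ×
  ((m : ℕ) (ns : Fin m → ℕ) (Ωs : (j : Fin m) → Weighting A B (ns j)) →
     InPlu A B c s m ns Ωs →
     InPlu A' B' c' s' m ns (λ j → weighting (win (Ωs j)) (pushΞ Ξ (wout (Ωs j)))))

-- Gap Label Cover GLC_{D,E}(1,ε), D = Fin d (sort zero), E = Fin e (sort suc zero);
-- symbols: all functions π : D → E, enumerated as Fin (e ^ d) via finToFun.

GLCSig : ℕ → ℕ → Signature
GLCSig d e = record
  { sorts  = 2
  ; nsym   = e ^ d
  ; arN    = λ _ → 2
  ; arSort = λ { _ zero → zero ; _ (suc _) → suc zero }
  }

GLCdom : ℕ → ℕ → Fin 2 → ℕ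
GLCdom d e zero    = d
GLCdom d e (suc _) = e

indicator : {e : ℕ} → Fin e → Fin e → ℚ
indicator x y = if ⌊ x ≟ y ⌋ then 1ℚ else 0ℚ

GLCStr : (d e : ℕ) → ValStr (GLCSig d e)
GLCStr d e = record
  { dom    = GLCdom d e
  ; interp = λ φ x → just (indicator (finToFun φ (x zero)) (x (suc zero)))
  }

pD : {d e n : ℕ} → PolFeas (GLCStr d e) (GLCStr d e) n → (Fin n → Fin d) → Fin d
pD p = proj₁ p zero

pE : {d e n : ℕ} → PolFeas (GLCStr d e) (GLCStr d e) n → (Fin n → Fin e) → Fin e
pE p = proj₁ p (suc zero)

{-# OPTIONS --safe #-}
-- (i) ⇒ (ii): a labelling (𝐝, 𝐞) consistent with π on Supp(Ω^in) is a GLC instance π(𝐝, 𝐞)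
-- of input value 1, so the κ-polymorphism inequality for the image (Ω^in, Ξ(Ω^out)) of the
-- singleton family (Ω) says exactly that its output value is at least ε.
-- (ii) ⇒ (i): the images of a family in Plu are κ'-polymorphisms of GLC(1, ε) for
-- κ' = max(ε, 0) · Σ 1/w, the sum running over all positive input weights w of the family.
-- On consistent instances (ii) gives output value ≥ ε; on an inconsistent one the input value
-- falls short of 1 by some positive weight w, and κ' w ≥ ε while output values are nonnegative.
-- Supports are preserved because positive weights multiply to positive weights.

module Submission where

open import Defs
open import Data.Nat using (ℕ)
open import Data.Fin using (Fin)
open import Data.Rational using (ℚ; 0ℚ; 1ℚ; _≤_; _<_)
open import Data.Product using (_×_)
open import Function.Bundles using (_⇔_)
open import Relation.Binary.PropositionalEquality using (_≡_)

open import Data.Nat using (zero; suc)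
open import Data.Fin using (zero; suc; finToFun; funToFin; _≟_)
open import Data.Vec.Functional using (tail)
open import Data.Fin.Properties using (finToFun-funToFin; any?)
open import Data.Rational using (_+_; _*_; _-_; -_; 1/_; _⊔_; positive; nonNegative)
open import Data.Rational.Properties hiding (_≟_)
open import Data.Rational.Solver using (module +-*-Solver)
open import Data.Product using (∃; _,_; proj₁; proj₂)
open import Data.List using ([]; _∷_; map; _++_)
open import Data.List.Relation.Unary.All as All using (All; []; _∷_)
import Data.List.Relation.Unary.All.Properties as Allₚ
import Data.List.Relation.Unary.Any as Any
import Data.List.Relation.Unary.Any.Properties as Anyₚ
open import Data.List.Membership.Propositional using (_∈_; lose)
open import Data.Empty using (⊥-elim)
open import Relation.Nullary using (yes; no; ¬_)
open import Relation.Nullary.Decidable using (_×-dec_; ¬?; decidable-stable)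
open import Relation.Binary.PropositionalEquality using (refl; trans; cong; cong₂; subst; subst₂)
import Relation.Binary.PropositionalEquality as ≡
open import Function.Bundles using (mk⇔)

open +-*-Solver
open ≤-Reasoning

0≤p*q : ∀ {p q} → 0ℚ ≤ p → 0ℚ ≤ q → 0ℚ ≤ p * q
0≤p*q {p} {q} 0≤p 0≤q =
  nonNegative⁻¹ (p * q) {{nonNeg*nonNeg⇒nonNeg p {{nonNegative 0≤p}} q {{nonNegative 0≤q}}}}

0<p*q : ∀ {p q} → 0ℚ < p → 0ℚ < q → 0ℚ < p * q
0<p*q {p} {q} 0<p 0<q = positive⁻¹ (p * q) {{pos*pos⇒pos p {{positive 0<p}} q {{positive 0<q}}}}

0≤p+q : ∀ {p q} → 0ℚ ≤ p → 0ℚ ≤ q → 0ℚ ≤ p + q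
0≤p+q {p} {q} 0≤p 0≤q =
  nonNegative⁻¹ (p + q) {{nonNeg+nonNeg⇒nonNeg p {{nonNegative 0≤p}} q {{nonNegative 0≤q}}}}

p≤q+p : ∀ {p q} → 0ℚ ≤ q → p ≤ q + p
p≤q+p {p} {q} 0≤q = subst (_≤ q + p) (+-identityˡ p) (+-monoˡ-≤ p 0≤q)

p*q≤p : ∀ {p q} → 0ℚ ≤ p → q ≤ 1ℚ → p * q ≤ p
p*q≤p {p} 0≤p q≤1 = subst (p * _ ≤_) (*-identityʳ p) (*-monoˡ-≤-nonNeg p {{nonNegative 0≤p}} q≤1)

p+q≤r⇒p-r≤-q : ∀ p q r → p + q ≤ r → p - r ≤ - q
p+q≤r⇒p-r≤-q p q r le = begin
  p - r                ≡⟨ solve 3 (λ p q r → p :- r := (p :+ q) :+ (:- q :- r)) refl p q r ⟩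
  (p + q) + (- q - r)  ≤⟨ +-monoˡ-≤ (- q - r) le ⟩
  r + (- q - r)        ≡⟨ solve 2 (λ q r → r :+ (:- q :- r) := :- q) refl q r ⟩
  - q                  ∎

p≤q+r⇒-r≤q-p : ∀ p q r → p ≤ q + r → - r ≤ q - p
p≤q+r⇒-r≤q-p p q r le = begin
  - r                  ≡⟨ solve 2 (λ p r → :- r := p :+ (:- r :- p)) refl p r ⟩
  p + (- r - p)        ≤⟨ +-monoˡ-≤ (- r - p) le ⟩
  (q + r) + (- r - p)  ≡⟨ solve 3 (λ p q r → (q :+ r) :+ (:- r :- p) := q :- p) refl p q r ⟩
  q - p                ∎

κ*[p-1]≤q-r : ∀ {κ p q r} → 0ℚ ≤ κ → (∃ λ w → p + w ≤ 1ℚ × r ≤ q + κ * w) →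
              κ * (p - 1ℚ) ≤ q - r
κ*[p-1]≤q-r {κ} {p} {q} {r} 0≤κ (w , p+w≤1 , r≤q+κw) = begin
  κ * (p - 1ℚ)  ≤⟨ *-monoˡ-≤-nonNeg κ {{nonNegative 0≤κ}} (p+q≤r⇒p-r≤-q p w 1ℚ p+w≤1) ⟩
  κ * (- w)     ≡⟨ ≡.sym (neg-distribʳ-* κ w) ⟩
  - (κ * w)     ≤⟨ p≤q+r⇒-r≤q-p r q (κ * w) r≤q+κw ⟩
  q - r         ∎

κ*[p-1]≤q-r⇒r≤q : ∀ κ {p q r} → p ≡ 1ℚ → κ * (p - 1ℚ) ≤ q - r → r ≤ q
κ*[p-1]≤q-r⇒r≤q κ {p} {q} {r} p≡1 le = begin
  r                ≡⟨ ≡.sym (+-identityʳ r) ⟩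
  r + 0ℚ           ≡⟨ cong (r +_) κ*[p-1]≡0 ⟨
  r + κ * (p - 1ℚ) ≤⟨ +-monoʳ-≤ r le ⟩
  r + (q - r)      ≡⟨ solve 2 (λ q r → r :+ (q :- r) := q) refl q r ⟩
  q                ∎
  where
    κ*[p-1]≡0 : κ * (p - 1ℚ) ≡ 0ℚ
    κ*[p-1]≡0 = begin-equality
      κ * (p - 1ℚ)   ≡⟨ cong (λ x → κ * (x - 1ℚ)) p≡1 ⟩
      κ * (1ℚ - 1ℚ)  ≡⟨ cong (κ *_) (+-inverseʳ 1ℚ) ⟩
      κ * 0ℚ         ≡⟨ *-zeroʳ κ ⟩
      0ℚ             ∎

inv⁺ : ℚ → ℚ
inv⁺ p with 0ℚ <? p
... | yes 0<p = (1/ p) {{pos⇒nonZero p {{positive 0<p}}}}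
... | no _    = 0ℚ

0≤inv⁺ : ∀ p → 0ℚ ≤ inv⁺ p
0≤inv⁺ p with 0ℚ <? p
... | yes 0<p = <⇒≤ (positive⁻¹ _ {{1/pos⇒pos p {{positive 0<p}}}})
... | no _    = ≤-refl

inv⁺-inverseˡ : ∀ {p} → 0ℚ < p → inv⁺ p * p ≡ 1ℚ
inv⁺-inverseˡ {p} 0<p with 0ℚ <? p
... | yes 0<p' = *-inverseˡ p {{pos⇒nonZero p {{positive 0<p'}}}}
... | no 0≮p   = ⊥-elim (0≮p 0<p)

sumFin-cong : ∀ n {g h : Fin n → ℚ} → (∀ i → g i ≡ h i) → sumFin n g ≡ sumFin n h
sumFin-cong zero    g≡h = refl
sumFin-cong (suc n) g≡h = cong₂ _+_ (g≡h zero) (sumFin-cong n (λ i → g≡h (suc i)))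

sumFin-mono : ∀ n {g h : Fin n → ℚ} → (∀ i → g i ≤ h i) → sumFin n g ≤ sumFin n h
sumFin-mono zero    g≤h = ≤-refl
sumFin-mono (suc n) g≤h = +-mono-≤ (g≤h zero) (sumFin-mono n (λ i → g≤h (suc i)))

sumFin-nonNeg : ∀ n {g : Fin n → ℚ} → (∀ i → 0ℚ ≤ g i) → 0ℚ ≤ sumFin n g
sumFin-nonNeg zero    0≤g = ≤-refl
sumFin-nonNeg (suc n) 0≤g = 0≤p+q (0≤g zero) (sumFin-nonNeg n (λ i → 0≤g (suc i)))

≤-sumFin : ∀ n {g : Fin n → ℚ} → (∀ i → 0ℚ ≤ g i) → ∀ i → g i ≤ sumFin n g
≤-sumFin (suc n) {g} 0≤g zero    = begin
  g zero               ≡⟨ ≡.sym (+-identityʳ (g zero)) ⟩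
  g zero + 0ℚ          ≤⟨ +-monoʳ-≤ (g zero) (sumFin-nonNeg n (λ i → 0≤g (suc i))) ⟩
  sumFin (suc n) g     ∎
≤-sumFin (suc n) {g} 0≤g (suc i) = begin
  g (suc i)            ≡⟨ ≡.sym (+-identityˡ (g (suc i))) ⟩
  0ℚ + g (suc i)       ≤⟨ +-mono-≤ (0≤g zero) (≤-sumFin n (λ i → 0≤g (suc i)) i) ⟩
  sumFin (suc n) g     ∎

sumFin-mono-gap : ∀ n {g h : Fin n → ℚ} δ → (∀ i → g i ≤ h i) →
                  ∀ i → g i + δ ≤ h i → sumFin n g + δ ≤ sumFin n h
sumFin-mono-gap (suc n) {g} {h} δ g≤h zero gap = begin
  (g zero + sumFin n (tail g)) + δ  ≡⟨ solve 3 (λ a b c → (a :+ b) :+ c := (a :+ c) :+ b) refl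
                                         (g zero) (sumFin n (tail g)) δ ⟩
  (g zero + δ) + sumFin n (tail g)  ≤⟨ +-mono-≤ gap (sumFin-mono n (λ i → g≤h (suc i))) ⟩
  sumFin (suc n) h                  ∎
sumFin-mono-gap (suc n) {g} {h} δ g≤h (suc i) gap = begin
  (g zero + sumFin n (tail g)) + δ  ≡⟨ +-assoc (g zero) (sumFin n (tail g)) δ ⟩
  g zero + (sumFin n (tail g) + δ)  ≤⟨ +-mono-≤ (g≤h zero)
                                         (sumFin-mono-gap n δ (λ i → g≤h (suc i)) i gap) ⟩
  sumFin (suc n) h                  ∎

module _ n {w g : Fin n → ℚ} (0≤w : ∀ i → 0ℚ ≤ w i) where

  sumFin-weighted-≤ : (∀ i → g i ≤ 1ℚ) → sumFin n (λ i → w i * g i) ≤ sumFin n w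
  sumFin-weighted-≤ g≤1 = sumFin-mono n (λ i → p*q≤p (0≤w i) (g≤1 i))

  sumFin-weighted-gap : (∀ i → g i ≤ 1ℚ) → ∀ i → g i ≡ 0ℚ →
                        sumFin n (λ i → w i * g i) + w i ≤ sumFin n w
  sumFin-weighted-gap g≤1 i g≡0 =
    sumFin-mono-gap n (w i) (λ i → p*q≤p (0≤w i) (g≤1 i)) i (≤-reflexive (begin-equality
      w i * g i + w i  ≡⟨ cong (λ x → w i * x + w i) g≡0 ⟩
      w i * 0ℚ + w i   ≡⟨ cong (_+ w i) (*-zeroʳ (w i)) ⟩
      0ℚ + w i         ≡⟨ +-identityˡ (w i) ⟩
      w i              ∎))

  sumFin-weighted-≡ : (∀ i → 0ℚ < w i → g i ≡ 1ℚ) → sumFin n (λ i → w i * g i) ≡ sumFin n w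
  sumFin-weighted-≡ g≡1 = sumFin-cong n term
    where
      term : ∀ i → w i * g i ≡ w i
      term i with 0ℚ <? w i
      ... | yes 0<w = trans (cong (w i *_) (g≡1 i 0<w)) (*-identityʳ (w i))
      ... | no 0≮w  = subst (λ x → x * g i ≡ x) (≤-antisym (0≤w i) (≮⇒≥ 0≮w)) (*-zeroˡ (g i))

scale-above-positive : (r : ℚ) (m : ℕ) (ns : Fin m → ℕ) (w : (j : Fin m) → Fin (ns j) → ℚ) →
                       ∃ λ κ → 0ℚ ≤ κ × (∀ j i → 0ℚ < w j i → r ≤ κ * w j i)
scale-above-positive r m ns w = r⁺ * K , 0≤p*q 0≤r⁺ 0≤K , r≤κw
  where
    r⁺ = r ⊔ 0ℚ
    0≤r⁺ : 0ℚ ≤ r⁺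
    0≤r⁺ = p≤q⊔p r 0ℚ
    K = sumFin m (λ j → sumFin (ns j) (λ i → inv⁺ (w j i)))
    0≤inner : ∀ j → 0ℚ ≤ sumFin (ns j) (λ i → inv⁺ (w j i))
    0≤inner j = sumFin-nonNeg (ns j) (λ i → 0≤inv⁺ (w j i))
    0≤K : 0ℚ ≤ K
    0≤K = sumFin-nonNeg m 0≤inner
    inv⁺≤K : ∀ j i → inv⁺ (w j i) ≤ K
    inv⁺≤K j i = ≤-trans (≤-sumFin (ns j) (λ i → 0≤inv⁺ (w j i)) i) (≤-sumFin m 0≤inner j)
    r≤κw : ∀ j i → 0ℚ < w j i → r ≤ r⁺ * K * w j i
    r≤κw j i 0<w = begin
      r                        ≤⟨ p≤p⊔q r 0ℚ ⟩
      r⁺                       ≡⟨ ≡.sym (*-identityʳ r⁺) ⟩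
      r⁺ * 1ℚ                  ≡⟨ cong (r⁺ *_) (≡.sym (inv⁺-inverseˡ 0<w)) ⟩
      r⁺ * (inv⁺ (w j i) * w j i)
        ≤⟨ *-monoˡ-≤-nonNeg r⁺ {{nonNegative 0≤r⁺}}
             (*-monoʳ-≤-nonNeg (w j i) {{nonNegative (<⇒≤ 0<w)}} (inv⁺≤K j i)) ⟩
      r⁺ * (K * w j i)         ≡⟨ ≡.sym (*-assoc r⁺ K (w j i)) ⟩
      r⁺ * K * w j i           ∎

indicator-≡ : ∀ {k} {x y : Fin k} → x ≡ y → indicator x y ≡ 1ℚ
indicator-≡ {x = x} {y} x≡y with x ≟ y
... | yes _   = refl
... | no x≢y = ⊥-elim (x≢y x≡y)

indicator-≢ : ∀ {k} {x y : Fin k} → ¬ x ≡ y → indicator x y ≡ 0ℚ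
indicator-≢ {x = x} {y} x≢y with x ≟ y
... | yes x≡y = ⊥-elim (x≢y x≡y)
... | no _    = refl

indicator≤1 : ∀ {k} (x y : Fin k) → indicator x y ≤ 1ℚ
indicator≤1 x y with x ≟ y
... | yes _ = ≤-refl
... | no _  = <⇒≤ (positive⁻¹ 1ℚ)

0≤indicator : ∀ {k} (x y : Fin k) → 0ℚ ≤ indicator x y
0≤indicator x y with x ≟ y
... | yes _ = <⇒≤ (positive⁻¹ 1ℚ)
... | no _  = ≤-refl

HasNonNegWeights : {X : Set} → Dist X → Set
HasNonNegWeights = All (λ p → 0ℚ ≤ proj₁ p)

module _ {X : Set} where

  expect-cong : (μ : Dist X) {g h : X → ℚ} → (∀ x → g x ≡ h x) → expect μ g ≡ expect μ h
  expect-cong []            g≡h = refl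
  expect-cong ((w , x) ∷ μ) g≡h = cong₂ _+_ (cong (w *_) (g≡h x)) (expect-cong μ g≡h)

  expect-nonNeg : (μ : Dist X) {g : X → ℚ} → HasNonNegWeights μ → (∀ x → 0ℚ ≤ g x) →
                  0ℚ ≤ expect μ g
  expect-nonNeg []            []          0≤g = ≤-refl
  expect-nonNeg ((w , x) ∷ μ) (0≤w ∷ μ≥0) 0≤g = 0≤p+q (0≤p*q 0≤w (0≤g x)) (expect-nonNeg μ μ≥0 0≤g)

  weightSum-++ : (μ ν : Dist X) → weightSum (μ ++ ν) ≡ weightSum μ + weightSum ν
  weightSum-++ []            ν = ≡.sym (+-identityˡ (weightSum ν))
  weightSum-++ ((w , _) ∷ μ) ν =
    trans (cong (w +_) (weightSum-++ μ ν)) (≡.sym (+-assoc w (weightSum μ) (weightSum ν)))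

  module _ {Y : Set} (a : ℚ) (F : X → Y) where

    rescale : Dist X → Dist Y
    rescale = map (λ p → (a * proj₁ p , F (proj₂ p)))

    weightSum-rescale : (μ : Dist X) → weightSum (rescale μ) ≡ a * weightSum μ
    weightSum-rescale []            = ≡.sym (*-zeroʳ a)
    weightSum-rescale ((w , _) ∷ μ) =
      trans (cong (a * w +_) (weightSum-rescale μ)) (≡.sym (*-distribˡ-+ a w (weightSum μ)))

    rescale-nonNeg : 0ℚ ≤ a → {μ : Dist X} → HasNonNegWeights μ → HasNonNegWeights (rescale μ)
    rescale-nonNeg 0≤a μ≥0 = Allₚ.map⁺ (All.map (0≤p*q 0≤a) μ≥0)

module _ {S S' : Signature} {A B : ValStr S} {A' B' : ValStr S'}
         {Ξ : Dist (MinionHom A B A' B')} {n : ℕ} where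

  weightSum-pushΞ : (μ : Dist (PolFeas A B n)) → weightSum (pushΞ Ξ μ) ≡ weightSum Ξ * weightSum μ
  weightSum-pushΞ μ = go Ξ
    where
      go : (Ξ : Dist (MinionHom A B A' B')) → weightSum (pushΞ Ξ μ) ≡ weightSum Ξ * weightSum μ
      go []            = ≡.sym (*-zeroˡ (weightSum μ))
      go ((a , ξ) ∷ Ξ) = begin-equality
        weightSum (rescale a (hom ξ) μ ++ pushΞ Ξ μ)
          ≡⟨ weightSum-++ (rescale a (hom ξ) μ) (pushΞ Ξ μ) ⟩
        weightSum (rescale a (hom ξ) μ) + weightSum (pushΞ Ξ μ)
          ≡⟨ cong₂ _+_ (weightSum-rescale a (hom ξ) μ) (go Ξ) ⟩
        a * weightSum μ + weightSum Ξ * weightSum μ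
          ≡⟨ ≡.sym (*-distribʳ-+ (weightSum μ) a (weightSum Ξ)) ⟩
        (a + weightSum Ξ) * weightSum μ ∎

  pushΞ-isDist : IsDist Ξ → {μ : Dist (PolFeas A B n)} → IsDist μ → IsDist (pushΞ Ξ μ)
  pushΞ-isDist (Ξ≥0 , ΣΞ≡1) {μ} (μ≥0 , Σμ≡1) =
      Allₚ.concat⁺ (Allₚ.map⁺ (All.map (λ 0≤a → rescale-nonNeg _ _ 0≤a μ≥0) Ξ≥0))
    , trans (weightSum-pushΞ μ) (trans (cong₂ _*_ ΣΞ≡1 Σμ≡1) (*-identityˡ 1ℚ))

  pushΞ-supp : ∀ {a ξ} → (a , ξ) ∈ Ξ → 0ℚ < a → {f : PolFeas A B n} {μ : Dist (PolFeas A B n)} →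
               InSupp (_≈F_ A B) f μ → InSupp (_≈F_ A' B') (hom ξ f) (pushΞ Ξ μ)
  pushΞ-supp {a} {ξ} ξ∈Ξ 0<a {f} f∈μ =
    Anyₚ.concat⁺ (Anyₚ.map⁺ (lose ξ∈Ξ (Anyₚ.map⁺ (Any.map hom-positive f∈μ))))
    where
      hom-positive : ∀ {p} → 0ℚ < proj₁ p × _≈F_ A B (proj₂ p) f →
                     0ℚ < a * proj₁ p × _≈F_ A' B' (hom ξ (proj₂ p)) (hom ξ f)
      hom-positive (0<w , g≈f) = 0<p*q 0<a 0<w , respects ξ _ f g≈f

pushWeighting : {S S' : Signature} {A B : ValStr S} {A' B' : ValStr S'} {n : ℕ} →
                Dist (MinionHom A B A' B') → Weighting A B n → Weighting A' B' n
pushWeighting Ξ Ω = weighting (win Ω) (pushΞ Ξ (wout Ω))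

pushWeighting-isWeighting : {S S' : Signature} {A B : ValStr S} {A' B' : ValStr S'} {n : ℕ}
  {Ξ : Dist (MinionHom A B A' B')} {Ω : Weighting A B n} →
  IsDist Ξ → IsWeighting A B Ω → IsWeighting A' B' (pushWeighting Ξ Ω)
pushWeighting-isWeighting Ξ-isDist (Ωin-isDist , Ωout-isDist) =
  Ωin-isDist , pushΞ-isDist Ξ-isDist Ωout-isDist

module _ {d e : ℕ} where

  private
    G = GLCStr d e

  glcMat : ∀ {n} φ → (Fin n → Fin d) → (Fin n → Fin e) → Mat G G φ n
  glcMat φ 𝐝 𝐞 zero       = 𝐝
  glcMat φ 𝐝 𝐞 (suc zero) = 𝐞

  IsLabelCoverSound : ∀ {n} → ℚ → Weighting G G n → Set
  IsLabelCoverSound {n} ε Ω =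
    (π : Fin d → Fin e) (𝐝 : Fin n → Fin d) (𝐞 : Fin n → Fin e) →
    ((i : Fin n) → 0ℚ < win Ω i → π (𝐝 i) ≡ 𝐞 i) →
    ε ≤ expect (wout Ω) (λ p → indicator (π (pD p 𝐝)) (pE p 𝐞))

  κPol⇒labelCoverSound : ∀ {n ε κ} {Ω : Weighting G G n} →
    IsDistFin n (win Ω) → IsκPol G G 1ℚ ε κ Ω → IsLabelCoverSound ε Ω
  κPol⇒labelCoverSound {n} {ε} {κ} {Ω} (0≤w , Σw≡1) isκ π 𝐝 𝐞 consistent = begin
    ε
      ≤⟨ κ*[p-1]≤q-r⇒r≤q κ inVal≡1 (isκ φ (glcMat φ 𝐝 𝐞) (λ _ → _ , refl)) ⟩
    outVal G G Ω φ (glcMat φ 𝐝 𝐞)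
      ≡⟨ expect-cong (wout Ω) (λ p →
           cong (λ x → indicator x (pE p 𝐞)) (finToFun-funToFin π (pD p 𝐝))) ⟩
    expect (wout Ω) (λ p → indicator (π (pD p 𝐝)) (pE p 𝐞))
      ∎
    where
      φ = funToFin π
      inVal≡1 : inVal G G Ω φ (glcMat φ 𝐝 𝐞) ≡ 1ℚ
      inVal≡1 = trans (sumFin-weighted-≡ n 0≤w (λ i 0<w →
                  indicator-≡ (trans (finToFun-funToFin π (𝐝 i)) (consistent i 0<w)))) Σw≡1

  labelCoverSound⇒κPol : ∀ {n ε κ} {Ω : Weighting G G n} →
    IsWeighting G G Ω → 0ℚ ≤ κ → (∀ i → 0ℚ < win Ω i → ε ≤ κ * win Ω i) →
    IsLabelCoverSound ε Ω → IsκPol G G 1ℚ ε κ Ω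
  labelCoverSound⇒κPol {n} {ε} {κ} {Ω} ((0≤w , Σw≡1) , μ≥0 , _) 0≤κ ε≤κw sound φ M _ =
    κ*[p-1]≤q-r {p = input} {q = output} 0≤κ deficit
    where
      input  = inVal G G Ω φ M
      output = outVal G G Ω φ M
      deficit : ∃ λ δ → input + δ ≤ 1ℚ × ε ≤ output + κ * δ
      deficit with any? (λ i → (0ℚ <? win Ω i) ×-dec ¬? (finToFun φ (M zero i) ≟ M (suc zero) i))
      ... | yes (i , 0<w , π𝐝≢𝐞) =
        win Ω i ,
        subst (input + win Ω i ≤_) Σw≡1
          (sumFin-weighted-gap n 0≤w (λ _ → indicator≤1 _ _) i (indicator-≢ π𝐝≢𝐞)) ,
        ≤-trans (ε≤κw i 0<w) (p≤q+p (expect-nonNeg (wout Ω) μ≥0 (λ _ → 0≤indicator _ _)))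
      ... | no ¬inconsistent =
        0ℚ ,
        subst₂ _≤_ (≡.sym (+-identityʳ input)) Σw≡1
          (sumFin-weighted-≤ n 0≤w (λ _ → indicator≤1 _ _)) ,
        subst (ε ≤_) (≡.sym (trans (cong (output +_) (*-zeroʳ κ)) (+-identityʳ output)))
          (sound (finToFun φ) (M zero) (M (suc zero)) consistent)
        where
          consistent : ∀ i → 0ℚ < win Ω i → finToFun φ (M zero i) ≡ M (suc zero) i
          consistent i 0<w = decidable-stable (_ ≟ _) (λ π𝐝≢𝐞 → ¬inconsistent (i , 0<w , π𝐝≢𝐞))

module _ {S : Signature} (A B : ValStr S) (c s : ℚ) {d e : ℕ} (ε : ℚ)
         (Ξ : Dist (MinionHom A B (GLCStr d e) (GLCStr d e))) where

  private
    G = GLCStr d e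

  LabelCoverCondition : Set
  LabelCoverCondition = (n : ℕ) (Ω : Weighting A B n) → IsPolymorphism A B c s Ω →
                        IsLabelCoverSound ε (pushWeighting Ξ Ω)

  valuedHom⇒labelCover : IsValuedMinionHomPlu A B c s G G 1ℚ ε Ξ → LabelCoverCondition
  valuedHom⇒labelCover (_ , preservesPlu) n Ω (isW , κ , 0≤κ , isκ) =
    let (_ , κ' , _ , isκ') = preservesPlu 1 (λ _ → n) (λ _ → Ω) ((λ _ → isW) , κ , 0≤κ , λ _ → isκ)
    in  κPol⇒labelCoverSound {κ = κ'} {Ω = pushWeighting Ξ Ω} (proj₁ isW) (isκ' zero)

  module _ (Ξ-isDist : IsDist Ξ) (condition : LabelCoverCondition) where

    labelCover⇒preservesPlu : (m : ℕ) (ns : Fin m → ℕ) (Ωs : (j : Fin m) → Weighting A B (ns j)) →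
      InPlu A B c s m ns Ωs → InPlu G G 1ℚ ε m ns (λ j → pushWeighting Ξ (Ωs j))
    labelCover⇒preservesPlu m ns Ωs (isW , κ , 0≤κ , isκ) =
      let (κ' , 0≤κ' , ε≤κ'w) = scale-above-positive ε m ns (λ j → win (Ωs j))
      in  pushedIsW , κ' , 0≤κ' , λ j →
            labelCoverSound⇒κPol (pushedIsW j) 0≤κ' (ε≤κ'w j)
              (condition (ns j) (Ωs j) (isW j , κ , 0≤κ , isκ j))
      where
        pushedIsW : ∀ j → IsWeighting G G (pushWeighting Ξ (Ωs j))
        pushedIsW j = pushWeighting-isWeighting Ξ-isDist (isW j)

    labelCover⇒valuedHom : IsValuedMinionHomPlu A B c s G G 1ℚ ε Ξ
    labelCover⇒valuedHom =
        All.tabulate (λ ξ∈Ξ 0<a n f (Ω , Ω∈Plu , f∈Ω) →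
          pushWeighting Ξ Ω , labelCover⇒preservesPlu 1 _ _ Ω∈Plu , pushΞ-supp ξ∈Ξ 0<a f∈Ω)
      , labelCover⇒preservesPlu

proposition16 :
    {S : Signature} (A B : ValStr S) (c s : ℚ) → IsValuedPromiseTemplate A B c s →
    (d e : ℕ) (ε : ℚ) (Ξ : Dist (MinionHom A B (GLCStr d e) (GLCStr d e))) → IsDist Ξ →
    IsValuedMinionHomPlu A B c s (GLCStr d e) (GLCStr d e) 1ℚ ε Ξ
      ⇔
    ((n : ℕ) (Ω : Weighting A B n) → IsPolymorphism A B c s Ω →
       (π : Fin d → Fin e) (𝐝 : Fin n → Fin d) (𝐞 : Fin n → Fin e) →
       ((i : Fin n) → 0ℚ < win Ω i → π (𝐝 i) ≡ 𝐞 i) →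
       ε ≤ expect (pushΞ Ξ (wout Ω)) (λ p → indicator (π (pD p 𝐝)) (pE p 𝐞)))
proposition16 A B c s _ d e ε Ξ Ξ-isDist =
  mk⇔ (valuedHom⇒labelCover A B c s ε Ξ) (labelCover⇒valuedHom A B c s ε Ξ Ξ-isDist)
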